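{- Let $c \in \mathbb{N}$. Then there exists a constant $C = C(c) \in \mathbb{N}$, depending only on $c$, such that for all $n \in \mathbb{N}$ and all $c$-quasihomomorphisms $f: \mathbb{Z} \to \mathbb{Q}^n$ we have \[ \forall x \in \mathbb{Z}: \qquad w_H\big(f(x) - x\cdot f(1)\big) \leq C. \] Moreover, one can take $C = 28c$.
   Context: For an abelian group $(Q,+)$ and $v \in Q^n$, the Hamming weight $w_H(v)$ is the number of nonzero entries of $v$. A function $f: \mathbb{Z} \to Q^n$ is a $c$-quasihomomorphism if $w_H\big(f(x+y) - f(x) - f(y)\big) \leq c$ for all $x,y \in \mathbb{Z}$. -}

module Defs where

open import Data.Nat using (ℕ; zero; suc; _+_)
open import Data.Fin using (Fin; zero; suc)
open import Data.Integer as ℤ using (ℤ)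
open import Data.Rational as ℚ using (ℚ; 0ℚ; 1ℚ; _≟_)
open import Relation.Nullary using (yes; no)

wH : ∀ {n} → (Fin n → ℚ) → ℕ
wH {zero}  v = 0
wH {suc n} v with v zero ≟ 0ℚ
... | yes _ = wH {n} (λ i → v (suc i))
... | no  _ = suc (wH {n} (λ i → v (suc i)))

_⊕_ : ∀ {n} → (Fin n → ℚ) → (Fin n → ℚ) → (Fin n → ℚ)
(u ⊕ v) i = u i ℚ.+ v i

_⊖_ : ∀ {n} → (Fin n → ℚ) → (Fin n → ℚ) → (Fin n → ℚ)
(u ⊖ v) i = u i ℚ.- v i

_·_ : ∀ {n} → ℤ → (Fin n → ℚ) → (Fin n → ℚ)
(x · v) i = (x ℚ./ 1) ℚ.* v i

IsQuasiHom : ℕ → ∀ {n} → (ℤ → Fin n → ℚ) → Set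
IsQuasiHom c f = ∀ (x y : ℤ) → wH ((f (x ℤ.+ y) ⊖ f x) ⊖ f y) Data.Nat.≤ c

-- Fix a coordinate h : ℤ → ℚ of f, let m = ∣ x ∣, and call (u, v) a defect of h when
-- h (u + v) ≠ h u + h v. For t ≤ m the differences Δ t k = h (t + k) − h k (k < N) can only
-- disagree at a defect, since h (t + k + k′) splits in two ways; so each t has a popular value,
-- missed by few k. If the weighted defect count W = 4·(defects in [0, L)²) + N·(defects (u, 1),
-- u < L) + N·(defects anchored at x) is below N², consecutive popular values differ by h 1 (some
-- k is good for both and has no defect at (t + k, 1)), so the popular value at m is m·h 1, and an
-- anchored pair without defect gives h x = x·h 1. Hence each coordinate where f x ≠ x·f 1 has
-- W ≥ N², while summed over all coordinates W ≤ c·(4L² + NL + N²), because each pair (u, v) is a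
-- defect of at most c coordinates. With N = m + 1 and L = m + N this is at most 28c·N².

module Submission where

open import Defs
open import Function using (_∘_)
open import Data.Nat using (ℕ; zero; suc; _+_; _*_; _≤_; _<_; z≤n; s≤s; s≤s⁻¹; z<s)
open import Data.Nat.Properties
  using ( ≤-refl; ≤-reflexive; ≤-trans; ≤-<-trans; <-≤-trans; ≰⇒>; <⇒≤; ≮⇒≥; _≤?_
        ; +-comm; +-assoc; +-suc; +-identityʳ; +-mono-≤; +-monoˡ-≤; +-monoʳ-≤; +-commutativeSemigroup
        ; m≤m+n; m≤n+m; m<m+n; m+n≡0⇒m≡0; m+n≡0⇒n≡0; m≤n⇒∃[o]m+o≡n
        ; *-identityˡ; *-monoˡ-≤; *-monoʳ-≤; *-distribˡ-+; *-distribʳ-+; *-cancelˡ-<; *-cancelʳ-<; *-cancelʳ-≤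
        ; module ≤-Reasoning )
open import Algebra.Properties.CommutativeSemigroup +-commutativeSemigroup using (interchange)
import Data.Nat.Coprimality as Coprime
open import Data.Nat.Solver renaming (module +-*-Solver to ℕ-Solver)
open import Data.Fin using (Fin; zero; suc)
open import Data.Integer as ℤ using (ℤ; +_; -[1+_]; 1ℤ; ∣_∣)
import Data.Integer.Properties as ℤ
open import Data.Rational as ℚ using (ℚ; 0ℚ; 1ℚ; mkℚ; _/_)
import Data.Rational.Properties as ℚ
open import Data.Rational.Solver renaming (module +-*-Solver to ℚ-Solver)
open import Data.Product using (Σ; ∃; _×_; _,_)
open import Relation.Binary.PropositionalEquality
open import Relation.Nullary using (Dec; yes; no; contradiction)

∑ : ℕ → (ℕ → ℕ) → ℕ
∑ zero    φ = 0
∑ (suc n) φ = ∑ n φ + φ n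

syntax ∑ n (λ k → e) = ∑[ k < n ] e

∑-cong : ∀ n {φ ψ : ℕ → ℕ} → (∀ k → φ k ≡ ψ k) → ∑ n φ ≡ ∑ n ψ
∑-cong zero    eq = refl
∑-cong (suc n) eq = cong₂ _+_ (∑-cong n eq) (eq n)

∑-mono : ∀ n {φ ψ : ℕ → ℕ} → (∀ k → φ k ≤ ψ k) → ∑ n φ ≤ ∑ n ψ
∑-mono zero    le = z≤n
∑-mono (suc n) le = +-mono-≤ (∑-mono n le) (le n)

∑-distrib-+ : ∀ n (φ ψ : ℕ → ℕ) → ∑[ k < n ] (φ k + ψ k) ≡ ∑ n φ + ∑ n ψ
∑-distrib-+ zero    φ ψ = refl
∑-distrib-+ (suc n) φ ψ = begin
  ∑[ k < n ] (φ k + ψ k) + (φ n + ψ n) ≡⟨ cong (_+ (φ n + ψ n)) (∑-distrib-+ n φ ψ) ⟩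
  ∑ n φ + ∑ n ψ + (φ n + ψ n)          ≡⟨ interchange (∑ n φ) (∑ n ψ) (φ n) (ψ n) ⟩
  ∑ n φ + φ n + (∑ n ψ + ψ n)          ∎
  where open ≡-Reasoning

∑-cong-+ : ∀ n {φ ψ χ : ℕ → ℕ} → (∀ k → φ k ≡ ψ k + χ k) → ∑ n φ ≡ ∑ n ψ + ∑ n χ
∑-cong-+ n {ψ = ψ} {χ} eq = trans (∑-cong n eq) (∑-distrib-+ n ψ χ)

∑-bounded : ∀ n {φ : ℕ → ℕ} {c} → (∀ k → φ k ≤ c) → ∑ n φ ≤ n * c
∑-bounded zero    le = z≤n
∑-bounded (suc n) {c = c} le = ≤-trans (+-mono-≤ (∑-bounded n le) (le n)) (≤-reflexive (+-comm (n * c) c))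

∑-split : ∀ t n (φ : ℕ → ℕ) → ∑ (t + n) φ ≡ ∑ t φ + ∑[ k < n ] φ (t + k)
∑-split t zero    φ = trans (cong (λ s → ∑ s φ) (+-identityʳ t)) (sym (+-identityʳ (∑ t φ)))
∑-split t (suc n) φ = begin
  ∑ (t + suc n) φ                                 ≡⟨ cong (λ s → ∑ s φ) (+-suc t n) ⟩
  ∑ (t + n) φ + φ (t + n)                         ≡⟨ cong (_+ φ (t + n)) (∑-split t n φ) ⟩
  ∑ t φ + ∑[ k < n ] φ (t + k) + φ (t + n)        ≡⟨ +-assoc (∑ t φ) _ _ ⟩
  ∑ t φ + (∑[ k < n ] φ (t + k) + φ (t + n))      ∎
  where open ≡-Reasoning

∑-shift-≤ : ∀ t {n L} (φ : ℕ → ℕ) → t + n ≤ L → ∑[ k < n ] φ (t + k) ≤ ∑ L φ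
∑-shift-≤ t {n} φ t+n≤L with m≤n⇒∃[o]m+o≡n t+n≤L
... | o , refl = begin
  ∑[ k < n ] φ (t + k)                      ≤⟨ m≤n+m _ (∑ t φ) ⟩
  ∑ t φ + ∑[ k < n ] φ (t + k)              ≡⟨ ∑-split t n φ ⟨
  ∑ (t + n) φ                               ≤⟨ m≤m+n _ _ ⟩
  ∑ (t + n) φ + ∑[ k < o ] φ (t + n + k)    ≡⟨ ∑-split (t + n) o φ ⟨
  ∑ (t + n + o) φ                           ∎
  where open ≤-Reasoning

∑²-block-≤ : ∀ s t {n L} (φ : ℕ → ℕ → ℕ) → s + n ≤ L → t + n ≤ L →
             ∑[ i < n ] ∑[ j < n ] φ (s + i) (t + j) ≤ ∑[ u < L ] ∑[ v < L ] φ u v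
∑²-block-≤ s t {n} {L} φ s+n≤L t+n≤L =
  ≤-trans (∑-mono n (λ i → ∑-shift-≤ t (φ (s + i)) t+n≤L)) (∑-shift-≤ s (λ u → ∑ L (φ u)) s+n≤L)

∑<n⇒∃-zero : ∀ n (φ : ℕ → ℕ) → ∑ n φ < n → ∃ λ k → k < n × φ k ≡ 0
∑<n⇒∃-zero (suc n) φ ∑<1+n with φ n in φn≡
... | zero  = n , ≤-refl , φn≡
... | suc v with ∑<n⇒∃-zero n φ (<-≤-trans (m<m+n (∑ n φ) z<s) (s≤s⁻¹ ∑<1+n))
...   | k , k<n , φk≡0 = k , <-≤-trans k<n (m≤n+m n 1) , φk≡0

n*∑<n*n⇒∃-zero : ∀ n (φ : ℕ → ℕ) → n * ∑ n φ < n * n → ∃ λ k → k < n × φ k ≡ 0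
n*∑<n*n⇒∃-zero n φ lt = ∑<n⇒∃-zero n φ (*-cancelˡ-< n (∑ n φ) n lt)

∃-below-average : ∀ n (φ : ℕ → ℕ) → 0 < n → ∃ λ k → k < n × n * φ k ≤ ∑ n φ
∃-below-average (suc zero)    φ _ = 0 , z<s , ≤-reflexive (+-identityʳ (φ 0))
∃-below-average (suc (suc n)) φ _ with ∃-below-average (suc n) φ z<s
... | k , k<1+n , avg with φ k ≤? φ (suc n)
...   | yes φk≤ = k , <-≤-trans k<1+n (m≤n+m _ 1) ,
  ≤-trans (+-mono-≤ φk≤ avg) (≤-reflexive (+-comm (φ (suc n)) _))
...   | no  φk≰ = suc n , ≤-refl ,
  ≤-trans (+-monoʳ-≤ (φ (suc n)) (≤-trans (*-monoʳ-≤ (suc n) (<⇒≤ (≰⇒> φk≰))) avg))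
          (≤-reflexive (+-comm (φ (suc n)) _))

mismatch : ∀ {p} {P : Set p} → Dec P → ℕ
mismatch (yes _) = 0
mismatch (no _)  = 1

mismatch≡0⇒ : ∀ {p} {P : Set p} (P? : Dec P) → mismatch P? ≡ 0 → P
mismatch≡0⇒ (yes p) _ = p

mismatch-≤-+ : ∀ {p} {P : Set p} (P? : Dec P) {a b} → (a ≡ 0 → b ≡ 0 → P) → mismatch P? ≤ a + b
mismatch-≤-+ (yes _)                   _ = z≤n
mismatch-≤-+ (no ¬p) {zero}  {zero}  P = contradiction (P refl refl) ¬p
mismatch-≤-+ (no _)  {zero}  {suc _} _ = s≤s z≤n
mismatch-≤-+ (no _)  {suc _}         _ = s≤s z≤n

nonzero : ℚ → ℕ
nonzero q = mismatch (q ℚ.≟ 0ℚ)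

wH-suc : ∀ {n} (v : Fin (suc n) → ℚ) → wH v ≡ nonzero (v zero) + wH (v ∘ suc)
wH-suc v with v zero ℚ.≟ 0ℚ
... | yes _ = refl
... | no  _ = refl

x-y-z≡0⇒x≡y+z : ∀ x y z → (x ℚ.- y) ℚ.- z ≡ 0ℚ → x ≡ y ℚ.+ z
x-y-z≡0⇒x≡y+z x y z eq = begin
  x                                  ≡⟨ solve 3 (λ x y z → x := (y :+ z) :+ ((x :- y) :- z)) refl x y z ⟩
  (y ℚ.+ z) ℚ.+ ((x ℚ.- y) ℚ.- z)    ≡⟨ cong ((y ℚ.+ z) ℚ.+_) eq ⟩
  (y ℚ.+ z) ℚ.+ 0ℚ                   ≡⟨ ℚ.+-identityʳ (y ℚ.+ z) ⟩
  y ℚ.+ z                            ∎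
  where open ≡-Reasoning; open ℚ-Solver

x+y′≡y+x′⇒x-y≡x′-y′ : ∀ x y x′ y′ → x ℚ.+ y′ ≡ y ℚ.+ x′ → x ℚ.- y ≡ x′ ℚ.- y′
x+y′≡y+x′⇒x-y≡x′-y′ x y x′ y′ eq = begin
  x ℚ.- y                          ≡⟨ solve 3 (λ x y y′ → x :- y := (x :+ y′) :- (y :+ y′)) refl x y y′ ⟩
  (x ℚ.+ y′) ℚ.- (y ℚ.+ y′)        ≡⟨ cong (ℚ._- (y ℚ.+ y′)) eq ⟩
  (y ℚ.+ x′) ℚ.- (y ℚ.+ y′)        ≡⟨ solve 3 (λ y x′ y′ → (y :+ x′) :- (y :+ y′) := x′ :- y′) refl y x′ y′ ⟩
  x′ ℚ.- y′                        ∎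
  where open ≡-Reasoning; open ℚ-Solver

[x+y]-z≡[x-z]+y : ∀ x y z → (x ℚ.+ y) ℚ.- z ≡ (x ℚ.- z) ℚ.+ y
[x+y]-z≡[x-z]+y = solve 3 (λ x y z → (x :+ y) :- z := (x :- z) :+ y) refl
  where open ℚ-Solver

x≡y+z⇒z≡x-y : ∀ x y z → x ≡ y ℚ.+ z → z ≡ x ℚ.- y
x≡y+z⇒z≡x-y x y z eq = trans (solve 2 (λ y z → z := (y :+ z) :- y) refl y z) (cong (ℚ._- y) (sym eq))
  where open ℚ-Solver

y≡x+z⇒z≡-[x-y] : ∀ x y z → y ≡ x ℚ.+ z → z ≡ ℚ.- (x ℚ.- y)
y≡x+z⇒z≡-[x-y] x y z eq =
  trans (solve 2 (λ x z → z := :- (x :- (x :+ z))) refl x z) (cong (λ w → ℚ.- (x ℚ.- w)) (sym eq))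
  where open ℚ-Solver

-- [+ t / 1] is a normalised fraction, so it can be unfolded to [mkℚ (+ t) 0 _], on which _+_ computes.
fromℕ-suc : ∀ t → + suc t / 1 ≡ + t / 1 ℚ.+ 1ℚ
fromℕ-suc t = begin
  + suc t / 1                   ≡⟨ cong (λ s → + s / 1) (+-comm 1 t) ⟩
  + (t + 1) / 1                 ≡⟨ cong (λ i → (i ℤ.+ + 1) / 1) (sym (ℤ.*-identityʳ (+ t))) ⟩
  mkℚ (+ t) 0 t⊥1 ℚ.+ 1ℚ        ≡⟨ cong (ℚ._+ 1ℚ) (ℚ.normalize-coprime {t} {0} t⊥1) ⟨
  + t / 1 ℚ.+ 1ℚ                ∎
  where
  open ≡-Reasoning
  t⊥1 : Coprime.Coprime t 1
  t⊥1 = Coprime.sym (Coprime.1-coprimeTo t)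

fromℕ-suc-* : ∀ t b → (+ t / 1) ℚ.* b ℚ.+ b ≡ (+ suc t / 1) ℚ.* b
fromℕ-suc-* t b = begin
  (+ t / 1) ℚ.* b ℚ.+ b          ≡⟨ solve 2 (λ i b → i :* b :+ b := (i :+ con 1ℚ) :* b) refl (+ t / 1) b ⟩
  (+ t / 1 ℚ.+ 1ℚ) ℚ.* b         ≡⟨ cong (ℚ._* b) (fromℕ-suc t) ⟨
  (+ suc t / 1) ℚ.* b            ∎
  where open ≡-Reasoning; open ℚ-Solver

defect : (ℤ → ℚ) → ℤ → ℤ → ℕ
defect h u v = nonzero ((h (u ℤ.+ v) ℚ.- h u) ℚ.- h v)

defects : ∀ {n} → (ℤ → Fin n → ℚ) → ℤ → ℤ → ℕ
defects f u v = wH ((f (u ℤ.+ v) ⊖ f u) ⊖ f v)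

defect≡0⇒additive : ∀ h {u v} → defect h u v ≡ 0 → h (u ℤ.+ v) ≡ h u ℚ.+ h v
defect≡0⇒additive h eq = x-y-z≡0⇒x≡y+z _ _ _ (mismatch≡0⇒ (_ ℚ.≟ 0ℚ) eq)

pairSum unitSum : ℕ → (ℤ → ℤ → ℕ) → ℕ
pairSum L β = ∑[ u < L ] ∑[ v < L ] β (+ u) (+ v)
unitSum L β = ∑[ u < L ] β (+ u) 1ℤ

module PopularDifference (h : ℤ → ℚ) (m N : ℕ) where

  L : ℕ
  L = m + N

  Δ : ℕ → ℕ → ℚ
  Δ t k = h (+ (t + k)) ℚ.- h (+ k)

  pairDefects : ℕ
  pairDefects = pairSum L (defect h)

  unitDefects : ℕ
  unitDefects = unitSum L (defect h)

  misses : ℕ → ℚ → ℕ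
  misses t q = ∑[ k < N ] mismatch (Δ t k ℚ.≟ q)

  Popular : ℕ → ℚ → Set
  Popular t q = N * misses t q ≤ 2 * pairDefects

  Sparse : Set
  Sparse = 4 * pairDefects + N * unitDefects < N * N

  -- Both defects vanishing means h (t + k + k′) splits in two ways, which forces Δ t k′ ≡ Δ t k.
  Δ-mismatch-≤ : ∀ t k k′ →
                 mismatch (Δ t k′ ℚ.≟ Δ t k) ≤ defect h (+ (t + k)) (+ k′) + defect h (+ k) (+ (t + k′))
  Δ-mismatch-≤ t k k′ = mismatch-≤-+ (Δ t k′ ℚ.≟ Δ t k) {defect h (+ (t + k)) (+ k′)} λ e₁ e₂ →
    sym (x+y′≡y+x′⇒x-y≡x′-y′ (h (+ (t + k))) (h (+ k)) (h (+ (t + k′))) (h (+ k′))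
          (trans (sym (defect≡0⇒additive h e₁)) (trans (cong (h ∘ +_) (regroup t k k′)) (defect≡0⇒additive h e₂))))
    where
    regroup : ∀ t k k′ → t + k + k′ ≡ k + (t + k′)
    regroup t k k′ = trans (cong (_+ k′) (+-comm t k)) (+-assoc k t k′)

  ∑-misses-≤ : ∀ t → t ≤ m → ∑[ k < N ] misses t (Δ t k) ≤ 2 * pairDefects
  ∑-misses-≤ t t≤m = begin
    ∑[ k < N ] misses t (Δ t k)
      ≤⟨ ∑-mono N (λ k → ∑-mono N (Δ-mismatch-≤ t k)) ⟩
    ∑[ k < N ] ∑[ k′ < N ] (defect h (+ (t + k)) (+ k′) + defect h (+ k) (+ (t + k′)))
      ≡⟨ trans (∑-cong N (λ k → ∑-distrib-+ N _ _)) (∑-distrib-+ N _ _) ⟩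
    ∑[ k < N ] ∑[ k′ < N ] defect h (+ (t + k)) (+ k′) + ∑[ k < N ] ∑[ k′ < N ] defect h (+ k) (+ (t + k′))
      ≤⟨ +-mono-≤ (∑²-block-≤ t 0 defectAt t+N≤L N≤L) (∑²-block-≤ 0 t defectAt N≤L t+N≤L) ⟩
    pairDefects + pairDefects
      ≡⟨ cong (_+_ pairDefects) (+-identityʳ pairDefects) ⟨
    2 * pairDefects ∎
    where
    open ≤-Reasoning
    defectAt : ℕ → ℕ → ℕ
    defectAt u v = defect h (+ u) (+ v)
    N≤L : N ≤ L
    N≤L = m≤n+m N m
    t+N≤L : t + N ≤ L
    t+N≤L = +-monoˡ-≤ N t≤m

  popular-misses-≤ : ∀ {t q} → Popular t q → N * misses t q ≤ 4 * pairDefects + N * unitDefects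
  popular-misses-≤ pop =
    ≤-trans pop (≤-trans (*-monoˡ-≤ pairDefects (m≤m+n 2 2)) (m≤m+n (4 * pairDefects) (N * unitDefects)))

  ∃-popular : ∀ t → t ≤ m → 0 < N → ∃ λ k → Popular t (Δ t k)
  ∃-popular t t≤m 0<N with ∃-below-average N (λ k → misses t (Δ t k)) 0<N
  ... | k , _ , avg = k , ≤-trans avg (∑-misses-≤ t t≤m)

  module _ (sparse : Sparse) where

    0<N : 0 < N
    0<N = *-cancelʳ-< N 0 N (≤-<-trans z≤n sparse)

    popular-suc : ∀ t {q q′} → t ≤ m → Popular (suc t) q → Popular t q′ → q ≡ q′ ℚ.+ h 1ℤ
    popular-suc t {q} {q′} t≤m pop pop′ = step (n*∑<n*n⇒∃-zero N φ few-failures)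
      where
      miss miss′ unit φ : ℕ → ℕ
      miss k  = mismatch (Δ (suc t) k ℚ.≟ q)
      miss′ k = mismatch (Δ t k ℚ.≟ q′)
      unit k  = defect h (+ (t + k)) 1ℤ
      φ k     = miss k + miss′ k + unit k

      few-failures : N * ∑ N φ < N * N
      few-failures = begin-strict
        N * ∑ N φ
          ≡⟨ cong (N *_) (trans (∑-distrib-+ N _ unit) (cong (_+ ∑ N unit) (∑-distrib-+ N miss miss′))) ⟩
        N * (misses (suc t) q + misses t q′ + ∑ N unit)
          ≡⟨ trans (*-distribˡ-+ N _ (∑ N unit))
                   (cong (_+ N * ∑ N unit) (*-distribˡ-+ N (∑ N miss) (∑ N miss′))) ⟩
        N * misses (suc t) q + N * misses t q′ + N * ∑ N unit
          ≤⟨ +-mono-≤ (+-mono-≤ pop pop′)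
                      (*-monoʳ-≤ N (∑-shift-≤ t (λ u → defect h (+ u) 1ℤ) (+-monoˡ-≤ N t≤m))) ⟩
        2 * pairDefects + 2 * pairDefects + N * unitDefects
          ≡⟨ cong (_+ N * unitDefects) (*-distribʳ-+ pairDefects 2 2) ⟨
        4 * pairDefects + N * unitDefects
          <⟨ sparse ⟩
        N * N ∎
        where open ≤-Reasoning

      step : (∃ λ k → k < N × φ k ≡ 0) → q ≡ q′ ℚ.+ h 1ℤ
      step (k , _ , φk≡0) = begin
        q                                       ≡⟨ mismatch≡0⇒ (Δ (suc t) k ℚ.≟ q) miss≡0 ⟨
        h (+ suc (t + k)) ℚ.- h (+ k)           ≡⟨ cong (λ s → h (+ s) ℚ.- h (+ k)) (+-comm 1 (t + k)) ⟩
        h (+ (t + k + 1)) ℚ.- h (+ k)           ≡⟨ cong (ℚ._- h (+ k)) (defect≡0⇒additive h unit≡0) ⟩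
        (h (+ (t + k)) ℚ.+ h 1ℤ) ℚ.- h (+ k)    ≡⟨ [x+y]-z≡[x-z]+y (h (+ (t + k))) (h 1ℤ) (h (+ k)) ⟩
        Δ t k ℚ.+ h 1ℤ                          ≡⟨ cong (ℚ._+ h 1ℤ) (mismatch≡0⇒ (Δ t k ℚ.≟ q′) miss′≡0) ⟩
        q′ ℚ.+ h 1ℤ                             ∎
        where
        open ≡-Reasoning
        misses≡0 : miss k + miss′ k ≡ 0
        misses≡0 = m+n≡0⇒m≡0 (miss k + miss′ k) φk≡0
        miss≡0 : miss k ≡ 0
        miss≡0 = m+n≡0⇒m≡0 (miss k) misses≡0
        miss′≡0 : miss′ k ≡ 0
        miss′≡0 = m+n≡0⇒n≡0 (miss k) misses≡0
        unit≡0 : unit k ≡ 0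
        unit≡0 = m+n≡0⇒n≡0 (miss k + miss′ k) φk≡0

    popular-value : ∀ t {q} → t ≤ m → Popular t q → q ≡ (+ t / 1) ℚ.* h 1ℤ
    popular-value zero {q} _ pop = base (n*∑<n*n⇒∃-zero N (λ k → mismatch (Δ 0 k ℚ.≟ q)) few-misses)
      where
      few-misses : N * misses 0 q < N * N
      few-misses = ≤-<-trans (popular-misses-≤ pop) sparse

      base : (∃ λ k → k < N × mismatch (Δ 0 k ℚ.≟ q) ≡ 0) → q ≡ 0ℚ ℚ.* h 1ℤ
      base (k , _ , Δ≡q) = begin
        q                       ≡⟨ mismatch≡0⇒ (Δ 0 k ℚ.≟ q) Δ≡q ⟨
        h (+ k) ℚ.- h (+ k)     ≡⟨ ℚ.+-inverseʳ (h (+ k)) ⟩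
        0ℚ                      ≡⟨ ℚ.*-zeroˡ (h 1ℤ) ⟨
        0ℚ ℚ.* h 1ℤ             ∎
        where open ≡-Reasoning
    popular-value (suc t) {q} 1+t≤m pop = step (∃-popular t t≤m 0<N)
      where
      t≤m : t ≤ m
      t≤m = <⇒≤ 1+t≤m

      step : (∃ λ k → Popular t (Δ t k)) → q ≡ (+ suc t / 1) ℚ.* h 1ℤ
      step (k , pop′) = begin
        q                                 ≡⟨ popular-suc t t≤m pop pop′ ⟩
        Δ t k ℚ.+ h 1ℤ                    ≡⟨ cong (ℚ._+ h 1ℤ) (popular-value t t≤m pop′) ⟩
        (+ t / 1) ℚ.* h 1ℤ ℚ.+ h 1ℤ       ≡⟨ fromℕ-suc-* t (h 1ℤ) ⟩
        (+ suc t / 1) ℚ.* h 1ℤ            ∎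
        where open ≡-Reasoning

-- The defect at (+ (anchor x + k), x) relates h x to Δ ∣ x ∣ k: for x = + m the pair is (k, m),
-- for x = - m it is (m + k, - m), whose sum is k.
anchor : ℤ → ℕ
anchor (+ _)    = 0
anchor -[1+ n ] = suc n

anchorSum : ℤ → ℕ → (ℤ → ℤ → ℕ) → ℕ
anchorSum x N β = ∑[ k < N ] β (+ (anchor x + k)) x

defectWeight : ℤ → ℕ → (ℤ → ℤ → ℕ) → ℕ
defectWeight x N β = 4 * pairSum L β + N * unitSum L β + N * anchorSum x N β
  where
  L : ℕ
  L = ∣ x ∣ + N

defectWeight-+ : ∀ x N {β β₁ β₂ : ℤ → ℤ → ℕ} → (∀ u v → β u v ≡ β₁ u v + β₂ u v) →
                 defectWeight x N β ≡ defectWeight x N β₁ + defectWeight x N β₂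
defectWeight-+ x N {β} {β₁} {β₂} split = begin
  4 * pairSum L β + N * unitSum L β + N * anchorSum x N β
    ≡⟨ cong₂ _+_ (cong₂ _+_ (cong (4 *_) (∑-cong-+ L λ u → ∑-cong-+ L λ v → split (+ u) (+ v)))
                            (cong (N *_) (∑-cong-+ L λ u → split (+ u) 1ℤ)))
                 (cong (N *_) (∑-cong-+ N λ k → split (+ (anchor x + k)) x)) ⟩
  4 * (a₁ + a₂) + N * (b₁ + b₂) + N * (c₁ + c₂)
    ≡⟨ solve 7 (λ N a₁ a₂ b₁ b₂ c₁ c₂ → con 4 :* (a₁ :+ a₂) :+ N :* (b₁ :+ b₂) :+ N :* (c₁ :+ c₂)
                 := (con 4 :* a₁ :+ N :* b₁ :+ N :* c₁) :+ (con 4 :* a₂ :+ N :* b₂ :+ N :* c₂))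
             refl N a₁ a₂ b₁ b₂ c₁ c₂ ⟩
  (4 * a₁ + N * b₁ + N * c₁) + (4 * a₂ + N * b₂ + N * c₂) ∎
  where
  open ≡-Reasoning
  open ℕ-Solver
  L a₁ a₂ b₁ b₂ c₁ c₂ : ℕ
  L  = ∣ x ∣ + N
  a₁ = pairSum L β₁
  a₂ = pairSum L β₂
  b₁ = unitSum L β₁
  b₂ = unitSum L β₂
  c₁ = anchorSum x N β₁
  c₂ = anchorSum x N β₂

defectWeight-≤ : ∀ x N {β : ℤ → ℤ → ℕ} {c} → (∀ u v → β u v ≤ c) →
                 defectWeight x N β ≤ 4 * ((∣ x ∣ + N) * ((∣ x ∣ + N) * c)) + N * ((∣ x ∣ + N) * c) + N * (N * c)
defectWeight-≤ x N β≤c =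
  +-mono-≤ (+-mono-≤ (*-monoʳ-≤ 4 (∑-bounded L λ u → ∑-bounded L λ v → β≤c (+ u) (+ v)))
                     (*-monoʳ-≤ N (∑-bounded L λ u → β≤c (+ u) 1ℤ)))
           (*-monoʳ-≤ N (∑-bounded N λ k → β≤c (+ (anchor x + k)) x))
  where
  L : ℕ
  L = ∣ x ∣ + N

anchored-value : ∀ (h : ℤ → ℚ) x k {b} →
                 h (+ (anchor x + k) ℤ.+ x) ≡ h (+ (anchor x + k)) ℚ.+ h x →
                 h (+ (∣ x ∣ + k)) ℚ.- h (+ k) ≡ (+ ∣ x ∣ / 1) ℚ.* b →
                 h x ≡ (x / 1) ℚ.* b
anchored-value h (+ m) k additive Δ≡ = begin
  h (+ m)                        ≡⟨ x≡y+z⇒z≡x-y (h (+ (k + m))) (h (+ k)) (h (+ m)) additive ⟩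
  h (+ (k + m)) ℚ.- h (+ k)      ≡⟨ cong (λ s → h (+ s) ℚ.- h (+ k)) (+-comm k m) ⟩
  h (+ (m + k)) ℚ.- h (+ k)      ≡⟨ Δ≡ ⟩
  (+ m / 1) ℚ.* _                ∎
  where open ≡-Reasoning
anchored-value h x@(-[1+ n ]) k {b} additive Δ≡ = begin
  h x                                         ≡⟨ y≡x+z⇒z≡-[x-y] (h (+ (suc n + k))) (h (+ k)) (h x)
                                                   (trans (cong h (sym m+k-m≡k)) additive) ⟩
  ℚ.- (h (+ (suc n + k)) ℚ.- h (+ k))         ≡⟨ cong ℚ.-_ Δ≡ ⟩
  ℚ.- ((+ suc n / 1) ℚ.* b)                   ≡⟨ ℚ.neg-distribˡ-* (+ suc n / 1) b ⟩
  (x / 1) ℚ.* b                               ∎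
  where
  open ≡-Reasoning
  m+k-m≡k : + (suc n + k) ℤ.+ x ≡ + k
  m+k-m≡k = trans (cong ((suc n + k) ℤ.⊖_) (sym (+-identityʳ (suc n)))) (ℤ.+-cancelˡ-⊖ (suc n) k 0)

defectWeight<N²⇒linear : ∀ (h : ℤ → ℚ) x N → defectWeight x N (defect h) < N * N → h x ≡ (x / 1) ℚ.* h 1ℤ
defectWeight<N²⇒linear h x N light =
  let k₀ , pop      = ∃-popular m ≤-refl (0<N sparse)
      k  , _ , φk≡0 = n*∑<n*n⇒∃-zero N (φ k₀) (few-failures k₀ pop)
  in  anchored-value h x k (defect≡0⇒additive h (m+n≡0⇒n≡0 _ φk≡0))
        (trans (mismatch≡0⇒ (Δ m k ℚ.≟ Δ m k₀) (m+n≡0⇒m≡0 _ φk≡0)) (popular-value sparse m ≤-refl pop))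
  where
  m : ℕ
  m = ∣ x ∣

  open PopularDifference h m N

  sparse : Sparse
  sparse = ≤-<-trans (m≤m+n _ _) light

  φ : ℕ → ℕ → ℕ
  φ k₀ k = mismatch (Δ m k ℚ.≟ Δ m k₀) + defect h (+ (anchor x + k)) x

  few-failures : ∀ k₀ → Popular m (Δ m k₀) → N * ∑ N (φ k₀) < N * N
  few-failures k₀ pop = begin-strict
    N * ∑ N (φ k₀)
      ≡⟨ trans (cong (N *_) (∑-distrib-+ N _ _)) (*-distribˡ-+ N _ _) ⟩
    N * misses m (Δ m k₀) + N * anchorSum x N (defect h)
      ≤⟨ +-monoˡ-≤ _ (popular-misses-≤ pop) ⟩
    4 * pairDefects + N * unitDefects + N * anchorSum x N (defect h)
      <⟨ light ⟩
    N * N ∎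
    where open ≤-Reasoning

nonzero-deviation-≤ : ∀ (h : ℤ → ℚ) x N →
                      nonzero (h x ℚ.- (x / 1) ℚ.* h 1ℤ) * (N * N) ≤ defectWeight x N (defect h)
nonzero-deviation-≤ h x N with h x ℚ.- (x / 1) ℚ.* h 1ℤ ℚ.≟ 0ℚ
... | yes _          = z≤n
... | no deviation≢0 = ≤-trans (≤-reflexive (*-identityˡ (N * N))) (≮⇒≥ (deviation≢0 ∘ deviation≡0))
  where
  deviation≡0 : defectWeight x N (defect h) < N * N → h x ℚ.- (x / 1) ℚ.* h 1ℤ ≡ 0ℚ
  deviation≡0 light = trans (cong (ℚ._- (x / 1) ℚ.* h 1ℤ) (defectWeight<N²⇒linear h x N light))
                            (ℚ.+-inverseʳ ((x / 1) ℚ.* h 1ℤ))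

wH-deviation-≤ : ∀ {n} (f : ℤ → Fin n → ℚ) x N →
  wH (f x ⊖ (x · f 1ℤ)) * (N * N) ≤ defectWeight x N (defects f)
wH-deviation-≤ {zero}  f x N = z≤n
wH-deviation-≤ {suc n} f x N = begin
  wH (f x ⊖ (x · f 1ℤ)) * (N * N)
    ≡⟨ trans (cong (_* (N * N)) (wH-suc (f x ⊖ (x · f 1ℤ))))
             (*-distribʳ-+ (N * N) (nonzero deviation) (wH (tail x ⊖ (x · tail 1ℤ)))) ⟩
  nonzero deviation * (N * N) + wH (tail x ⊖ (x · tail 1ℤ)) * (N * N)
    ≤⟨ +-mono-≤ (nonzero-deviation-≤ head x N) (wH-deviation-≤ tail x N) ⟩
  defectWeight x N (defect head) + defectWeight x N (defects tail)
    ≡⟨ defectWeight-+ x N {β₁ = defect head} {β₂ = defects tail}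
                      (λ u v → wH-suc ((f (u ℤ.+ v) ⊖ f u) ⊖ f v)) ⟨
  defectWeight x N (defects f) ∎
  where
  open ≤-Reasoning
  head : ℤ → ℚ
  head u = f u zero
  tail : ℤ → Fin n → ℚ
  tail u = f u ∘ suc
  deviation : ℚ
  deviation = head x ℚ.- (x / 1) ℚ.* head 1ℤ

-- With N = m + 1 and L = 2m + 1 the bound is c (19m² + 21m + 6); the slack is what remains of 28c (m + 1)².
weight-polynomial-≤ : ∀ m c → let N = suc m; L = m + N in
                 4 * (L * (L * c)) + N * (L * c) + N * (N * c) ≤ 28 * c * (N * N)
weight-polynomial-≤ m c = ≤-trans (m≤m+n _ (c * (9 * (m * m) + 35 * m + 22)))
  (≤-reflexive (solve 2 (λ m c → let N = con 1 :+ m; L = m :+ N in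
                          con 4 :* (L :* (L :* c)) :+ N :* (L :* c) :+ N :* (N :* c)
                            :+ c :* (con 9 :* (m :* m) :+ con 35 :* m :+ con 22)
                          := con 28 :* c :* (N :* N))
                      refl m c))
  where open ℕ-Solver

quasiHom-deviation-≤ : ∀ c {n} (f : ℤ → Fin n → ℚ) → IsQuasiHom c f → ∀ x → wH (f x ⊖ (x · f 1ℤ)) ≤ 28 * c
quasiHom-deviation-≤ c f quasi x = *-cancelʳ-≤ _ (28 * c) (N * N) (begin
  wH (f x ⊖ (x · f 1ℤ)) * (N * N)                              ≤⟨ wH-deviation-≤ f x N ⟩
  defectWeight x N (defects f)                                 ≤⟨ defectWeight-≤ x N quasi ⟩
  _                                                            ≤⟨ weight-polynomial-≤ ∣ x ∣ c ⟩
  28 * c * (N * N)                                             ∎)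
  where
  open ≤-Reasoning
  N : ℕ
  N = suc ∣ x ∣

mainTheorem1 : (c : ℕ) →
    Σ ℕ (λ C → ∀ (n : ℕ) (f : ℤ → Fin n → ℚ) → IsQuasiHom c f →
                 ∀ (x : ℤ) → wH (f x ⊖ (x · f 1ℤ)) ≤ C)
    × (∀ (n : ℕ) (f : ℤ → Fin n → ℚ) → IsQuasiHom c f →
                 ∀ (x : ℤ) → wH (f x ⊖ (x · f 1ℤ)) ≤ 28 * c)
mainTheorem1 c = (28 * c , bound) , bound
  where
  bound : ∀ (n : ℕ) (f : ℤ → Fin n → ℚ) → IsQuasiHom c f → ∀ x → wH (f x ⊖ (x · f 1ℤ)) ≤ 28 * c
  bound n = quasiHom-deviation-≤ c
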